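{- Let $p$ be a pattern. Then $p$ is avoidable in the ordinary sense if and only if $p$ is avoidable up to $\simeq$.
   Context: For a word $x=x_1\cdots x_n$ (letters $x_i$), its reversal is $x^R=x_n\cdots x_1$. Let $\simeq$ be the equivalence relation on words with $x\simeq x'$ iff $x'=x$ or $x'=x^R$. A pattern is a word $p=p_1p_2\cdots p_n$ over an alphabet $V$ of variables. For an equivalence relation $\sim$ on words, a word $w$ encounters $p$ up to $\sim$ if $w$ has a factor $X_1X_2\cdots X_n$ where each $X_i$ is a nonempty word and $X_i\sim X_j$ whenever $p_i=p_j$; otherwise $w$ avoids $p$ up to $\sim$. The pattern $p$ is $k$-avoidable up to $\sim$ if some infinite word over a $k$-letter alphabet avoids $p$ up to $\sim$, and avoidable up to $\sim$ if it is $k$-avoidable up to $\sim$ for some $k$. Avoidable in the ordinary sense means avoidable up to equality $=$. -}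

module Defs where

open import Data.Nat using (ℕ; _+_)
open import Data.Fin using (Fin; toℕ)
open import Data.List using (List; []; length; reverse; concat; map; upTo)
open import Data.List.Base using (lookup)
open import Data.Product using (Σ; ∃; ∃-syntax; _×_)
open import Data.Sum using (_⊎_)
open import Relation.Binary.PropositionalEquality using (_≡_; _≢_)
open import Relation.Nullary using (¬_)

WordRel : Set₁
WordRel = {A : Set} → List A → List A → Set

_≐_ : WordRel
x ≐ y = x ≡ y

_≃_ : WordRel
x ≃ y = (y ≡ x) ⊎ (y ≡ reverse x)

segment : {A : Set} → (ℕ → A) → ℕ → ℕ → List A
segment w i l = map (λ j → w (i + j)) (upTo l)

NonEmpty : {A : Set} → List A → Set
NonEmpty xs = xs ≢ []

Encounters : {A V : Set} → WordRel → (ℕ → A) → List V → Set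
Encounters {A} _∼_ w p =
  ∃[ i ] Σ (Fin (length p) → List A) λ X →
      ((j : Fin (length p)) → NonEmpty (X j))
    × ((j k : Fin (length p)) → lookup p j ≡ lookup p k → X j ∼ X k)
    × (concat (map X (Data.List.allFin (length p))) ≡
         segment w i (length (concat (map X (Data.List.allFin (length p))))))

Avoids : {A V : Set} → WordRel → (ℕ → A) → List V → Set
Avoids _∼_ w p = ¬ Encounters _∼_ w p

KAvoidable : {V : Set} → WordRel → ℕ → List V → Set
KAvoidable _∼_ k p = Σ (ℕ → Fin k) λ w → Avoids _∼_ w p

Avoidable : {V : Set} → WordRel → List V → Set
Avoidable _∼_ p = ∃[ k ] KAvoidable _∼_ k p

-- Avoidance up to equality implies avoidance up to reversal: tag the i-th letter of an
-- avoiding word with i mod 3. In the tagged word the tags of every factor advance by one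
-- step of the 3-cycle from letter to letter, so a factor of length at least two is never
-- the reversal of another factor; hence X ≃ Y between factors forces X = Y, and erasing
-- the tags turns an encounter up to ≃ into an ordinary encounter in the original word.
-- The converse holds because ≐ is finer than ≃.
module Submission where

open import Defs
open import Data.List using (List)
open import Function.Bundles using (_⇔_)

open import Level using (Level)
open import Data.Nat using (ℕ; zero; suc; _+_; _*_)
open import Data.Nat.Properties using (+-suc)
open import Data.Fin using (Fin; combine; remQuot) renaming (zero to fz; suc to fs)
open import Data.Fin.Properties using (remQuot-combine)
open import Data.List using ([]; _∷_; _++_; reverse; concat; map; length; allFin)
open import Data.List.Properties using (concat-map; map-∘; map-cong; length-map; reverse-++)
open import Data.List.Membership.Propositional using (_∈_)
open import Data.List.Membership.Propositional.Properties using (∈-allFin)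
open import Data.List.Relation.Unary.Any using (here; there)
open import Data.List.Relation.Unary.Linked as Linked using (Linked; []; [-]; _∷_)
open import Data.List.Relation.Unary.Linked.Properties using (map⁺; applyUpTo⁺₂)
open import Data.Product using (_,_; proj₁; proj₂)
open import Data.Sum using (inj₁; inj₂)
open import Data.Empty using (⊥-elim)
open import Function using (_∘_; id; _on_; mk⇔)
open import Relation.Binary.Core using (Rel)
open import Relation.Binary.Definitions using (Asymmetric)
open import Relation.Binary.PropositionalEquality
  using (_≡_; _≢_; refl; sym; trans; cong; subst; module ≡-Reasoning)

module _ {ℓ : Level} {A : Set} {R : Rel A ℓ} where

  Linked-++⁻ˡ : ∀ xs {ys} → Linked R (xs ++ ys) → Linked R xs
  Linked-++⁻ˡ []           _          = []
  Linked-++⁻ˡ (x ∷ [])     _          = [-]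
  Linked-++⁻ˡ (x ∷ y ∷ xs) (Rxy ∷ Rs) = Rxy ∷ Linked-++⁻ˡ (y ∷ xs) Rs

  Linked-++⁻ʳ : ∀ xs {ys} → Linked R (xs ++ ys) → Linked R ys
  Linked-++⁻ʳ []       Rs = Rs
  Linked-++⁻ʳ (x ∷ xs) Rs = Linked-++⁻ʳ xs (Linked.tail Rs)

  Linked-concat⁻ : ∀ {I : Set} (X : I → List A) {is} → Linked R (concat (map X is)) →
                   ∀ {i} → i ∈ is → Linked R (X i)
  Linked-concat⁻ X {i ∷ _} Rs (here refl) = Linked-++⁻ˡ (X i) Rs
  Linked-concat⁻ X {i ∷ _} Rs (there i∈)  = Linked-concat⁻ X (Linked-++⁻ʳ (X i) Rs) i∈

  reverse-Linked⇒≡ : Asymmetric R → ∀ {xs} → Linked R xs → Linked R (reverse xs) →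
                     reverse xs ≡ xs
  reverse-Linked⇒≡ asym []  _ = refl
  reverse-Linked⇒≡ asym [-] _ = refl
  reverse-Linked⇒≡ asym {x ∷ y ∷ zs} (Rxy ∷ _) Rrev = ⊥-elim (asym Rxy Ryx)
    where
    -- reverse (x ∷ y ∷ zs) ends in y ∷ x ∷ [].
    Ryx : R y x
    Ryx = Linked.head (Linked-++⁻ʳ (reverse zs)
                        (subst (Linked R) (reverse-++ (x ∷ y ∷ []) zs) Rrev))

  ≃⇒≐-on-Linked : Asymmetric R → ∀ {xs ys} → Linked R xs → Linked R ys → xs ≃ ys → xs ≐ ys
  ≃⇒≐-on-Linked asym Rxs Rys (inj₁ ys≡xs)    = sym ys≡xs
  ≃⇒≐-on-Linked asym Rxs Rys (inj₂ ys≡revxs) =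
    trans (sym (reverse-Linked⇒≡ asym Rxs (subst (Linked R) ys≡revxs Rys))) (sym ys≡revxs)

segment-Linked : {A : Set} {ℓ : Level} {R : Rel A ℓ} (w : ℕ → A) →
                 (∀ m → R (w m) (w (suc m))) → ∀ i l → Linked R (segment w i l)
segment-Linked {R = R} w step i l = map⁺ (applyUpTo⁺₂ id l step-from-i)
  where
  step-from-i : ∀ j → (R on (λ j → w (i + j))) j (suc j)
  step-from-i j = subst (R (w (i + j)) ∘ w) (sym (+-suc i j)) (step (i + j))

segment-map : {A B : Set} (f : A → B) {w : ℕ → A} {v : ℕ → B} → (∀ m → f (w m) ≡ v m) →
              ∀ i l → map f (segment w i l) ≡ segment v i l
segment-map f fw≗v i l = trans (sym (map-∘ _)) (map-cong (λ j → fw≗v (i + j)) _)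

map-NonEmpty : {A B : Set} (f : A → B) {xs : List A} → NonEmpty xs → NonEmpty (map f xs)
map-NonEmpty f {[]}    xs≢[] = λ _ → xs≢[] refl
map-NonEmpty f {_ ∷ _} _     = λ ()

Encounters-mono : {A V : Set} {_∼_ _≈_ : WordRel} → (∀ {B} {x y : List B} → x ∼ y → x ≈ y) →
                  {w : ℕ → A} (p : List V) → Encounters _∼_ w p → Encounters _≈_ w p
Encounters-mono ∼⇒≈ p (i , X , X≢[] , X-rel , X-factor) =
  i , X , X≢[] , (λ j l e → ∼⇒≈ (X-rel j l e)) , X-factor

Avoidable-antimono : {V : Set} {_∼_ _≈_ : WordRel} → (∀ {B} {x y : List B} → x ∼ y → x ≈ y) →
                     (p : List V) → Avoidable _≈_ p → Avoidable _∼_ p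
Avoidable-antimono {_∼_ = _∼_} {_≈_} ∼⇒≈ p (k , w , avoids) =
  k , w , avoids ∘ Encounters-mono {_∼_ = _∼_} {_≈_} ∼⇒≈ {w} p

Encounters-≐-map : {A B V : Set} (f : A → B) {w : ℕ → A} {v : ℕ → B} → (∀ m → f (w m) ≡ v m) →
                   (p : List V) → Encounters _≐_ w p → Encounters _≐_ v p
Encounters-≐-map f {w} {v} fw≗v p (i , X , X≢[] , X-rel , X-factor) =
  i , Y , (λ j → map-NonEmpty f (X≢[] j)) , (λ j l e → cong (map f) (X-rel j l e)) , Y-factor
  where
  open ≡-Reasoning
  Y : Fin (length p) → List _
  Y = map f ∘ X

  js : List (Fin (length p))
  js = allFin (length p)

  L : ℕ
  L = length (concat (map X js))

  concat-Y : concat (map Y js) ≡ map f (concat (map X js))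
  concat-Y = trans (cong concat (map-∘ js)) (concat-map (map X js))

  length-Y : L ≡ length (concat (map Y js))
  length-Y = sym (trans (cong length concat-Y) (length-map f (concat (map X js))))

  Y-factor : concat (map Y js) ≡ segment v i (length (concat (map Y js)))
  Y-factor = begin
    concat (map Y js)                ≡⟨ concat-Y ⟩
    map f (concat (map X js))        ≡⟨ cong (map f) X-factor ⟩
    map f (segment w i L)            ≡⟨ segment-map f fw≗v i L ⟩
    segment v i L                    ≡⟨ cong (segment v i) length-Y ⟩
    segment v i (length (concat (map Y js))) ∎

Encounters-≃⇒≐ : {A V : Set} {ℓ : Level} {R : Rel A ℓ} → Asymmetric R →
                 (w : ℕ → A) → (∀ m → R (w m) (w (suc m))) →
                 (p : List V) → Encounters _≃_ w p → Encounters _≐_ w p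
Encounters-≃⇒≐ {R = R} asym w step p (i , X , X≢[] , X-rel , X-factor) =
  i , X , X≢[] , (λ j l e → ≃⇒≐-on-Linked asym (Linked-X j) (Linked-X l) (X-rel j l e)) , X-factor
  where
  Linked-X : ∀ j → Linked R (X j)
  Linked-X j = Linked-concat⁻ X (subst (Linked R) (sym X-factor) (segment-Linked w step i _))
                 (∈-allFin j)

rotate : Fin 3 → Fin 3
rotate fz           = fs fz
rotate (fs fz)      = fs (fs fz)
rotate (fs (fs fz)) = fz

rotate²≢id : ∀ t → rotate (rotate t) ≢ t
rotate²≢id fz           ()
rotate²≢id (fs fz)      ()
rotate²≢id (fs (fs fz)) ()

clock : ℕ → Fin 3
clock zero    = fz
clock (suc m) = rotate (clock m)

module Tagged (k : ℕ) where

  letter : Fin (k * 3) → Fin k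
  letter c = proj₁ (remQuot {k} 3 c)

  tag : Fin (k * 3) → Fin 3
  tag c = proj₂ (remQuot {k} 3 c)

  tagged : (ℕ → Fin k) → ℕ → Fin (k * 3)
  tagged w m = combine (w m) (clock m)

  _⇝_ : Rel (Fin (k * 3)) Level.zero
  c ⇝ d = tag d ≡ rotate (tag c)

  ⇝-asym : Asymmetric _⇝_
  ⇝-asym {c} {d} c⇝d d⇝c = rotate²≢id (tag c) (sym (trans d⇝c (cong rotate c⇝d)))

  letter-tagged : ∀ w m → letter (tagged w m) ≡ w m
  letter-tagged w m = cong proj₁ (remQuot-combine {k} {3} (w m) (clock m))

  tag-tagged : ∀ w m → tag (tagged w m) ≡ clock m
  tag-tagged w m = cong proj₂ (remQuot-combine {k} {3} (w m) (clock m))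

  tagged-step : ∀ w m → tagged w m ⇝ tagged w (suc m)
  tagged-step w m = trans (tag-tagged w (suc m)) (cong rotate (sym (tag-tagged w m)))

  Encounters-tagged : ∀ {V : Set} w (p : List V) →
                      Encounters _≃_ (tagged w) p → Encounters _≐_ w p
  Encounters-tagged w p =
    Encounters-≐-map letter {tagged w} {w} (letter-tagged w) p
    ∘ Encounters-≃⇒≐ {R = _⇝_} ⇝-asym (tagged w) (tagged-step w) p

Avoidable-≐⇒≃ : {V : Set} (p : List V) → Avoidable _≐_ p → Avoidable _≃_ p
Avoidable-≐⇒≃ p (k , w , avoids) = k * 3 , tagged w , avoids ∘ Encounters-tagged w p
  where open Tagged k

theorem2 : {V : Set} (p : List V) → Avoidable _≐_ p ⇔ Avoidable _≃_ p
theorem2 p = mk⇔ (Avoidable-≐⇒≃ p) (Avoidable-antimono {_∼_ = _≐_} {_≃_} (inj₁ ∘ sym) p)
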